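{- Let $w$ and $a$ be words with $|a|\le 1$. Then $wa$ has a nontrivial palindromic prefix if and only if $waw^R$ has a nontrivial proper palindromic prefix.
   Context: $w^R$ is the reverse of $w$; a palindrome is a word equal to its reverse, and it is nontrivial if its length is at least $2$. A palindromic prefix of a word may be the word itself; a proper prefix of $x$ is a prefix of length strictly less than $|x|$. -}

module Defs where

open import Data.List using (List; reverse; length; _++_)
open import Data.Nat using (ℕ; _≤_; _<_)
open import Data.Product using (Σ; _×_; ∃-syntax)
open import Relation.Binary.PropositionalEquality using (_≡_)

IsPrefix : ∀ {a} {A : Set a} → List A → List A → Set a
IsPrefix {A = A} p x = Σ (List A) (λ s → p ++ s ≡ x)

IsPalindrome : ∀ {a} {A : Set a} → List A → Set a
IsPalindrome p = reverse p ≡ p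

IsNontrivialPalindrome : ∀ {a} {A : Set a} → List A → Set a
IsNontrivialPalindrome p = IsPalindrome p × 2 ≤ length p

HasNontrivPalPrefix : ∀ {a} {A : Set a} → List A → Set a
HasNontrivPalPrefix {A = A} x =
  ∃[ p ] (IsPrefix p x × IsNontrivialPalindrome p)

HasNontrivProperPalPrefix : ∀ {a} {A : Set a} → List A → Set a
HasNontrivProperPalPrefix {A = A} x =
  ∃[ p ] (IsPrefix p x × length p < length x × IsNontrivialPalindrome p)

-- A nontrivial palindromic prefix of wa stays one of waw^R and is proper, because it forces
-- w ≠ []. Conversely, waw^R is a palindrome, so for a palindromic prefix p with waw^R = ps
-- the word ps is a palindrome as well; when |s| ≤ |p| this forces p = p′s with p′ again a
-- palindrome. Stripping copies of s off p until it fits into wa leaves a palindromic prefix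
-- q of wa with |wa| < |q| + |s|, and since |s| < |w| this gives |q| ≥ |a| + 2.
module Submission where

open import Defs
open import Data.List using (List; []; _∷_; reverse; length; _++_)
open import Data.List.Properties
  using (++-assoc; ++-identityʳ; ++-cancelˡ; ∷-injective; length-++; length-++-≤ˡ;
         length-reverse; reverse-++; reverse-involutive)
open import Data.Nat using (_+_; _≤_; _<_; z≤n; s≤s; _≤?_)
open import Data.Nat.Induction using (<-wellFounded)
open import Data.Nat.Properties
  using (≤-trans; ≤-<-trans; <⇒≤; ≰⇒>; m≤m+n; m<m+n; +-identityʳ; +-monoˡ-<;
         +-cancelˡ-<; +-cancelʳ-≤)
open import Data.Product using (_×_; _,_; ∃-syntax)
open import Function.Bundles using (_⇔_; mk⇔)
open import Induction.WellFounded using (Acc; acc)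
open import Relation.Binary.PropositionalEquality
  using (_≡_; refl; sym; trans; cong; cong₂; subst; subst₂; module ≡-Reasoning)
open import Relation.Nullary using (yes; no)

open ≡-Reasoning

window-lower-bound : ∀ {m n k l} → m < n + k → k < l → l ≤ m → 2 ≤ n
window-lower-bound {n = n} {k} m<n+k k<l l≤m =
  +-cancelʳ-≤ k 2 n (≤-trans (s≤s k<l) (≤-trans (s≤s l≤m) m<n+k))

module _ {ℓ} {A : Set ℓ} where

  prefix-trans : ∀ {p q x : List A} → IsPrefix p q → IsPrefix q x → IsPrefix p x
  prefix-trans {p} (t , refl) (r , qr≡x) = t ++ r , trans (sym (++-assoc p t r)) qr≡x

  length-prefix : ∀ {p x : List A} → IsPrefix p x → length p ≤ length x
  length-prefix {p} (_ , refl) = length-++-≤ˡ p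

  prefix-of-left-factor : ∀ p u {v : List A} → IsPrefix p (u ++ v) → length p ≤ length u →
                          IsPrefix p u
  prefix-of-left-factor [] u _ _ = u , refl
  prefix-of-left-factor (x ∷ p) (y ∷ u) (t , eq) (s≤s p≤u) with ∷-injective eq
  ... | refl , pt≡uv with prefix-of-left-factor p u (t , pt≡uv) p≤u
  ...   | r , pr≡u = r , cong (x ∷_) pr≡u

  palindrome-of-length≤1 : ∀ (a : List A) → length a ≤ 1 → IsPalindrome a
  palindrome-of-length≤1 []          _ = refl
  palindrome-of-length≤1 (_ ∷ [])    _ = refl
  palindrome-of-length≤1 (_ ∷ _ ∷ _) (s≤s ())

  palindrome-++-reverse : ∀ w {a : List A} → IsPalindrome a → IsPalindrome ((w ++ a) ++ reverse w)
  palindrome-++-reverse w {a} a-pal = begin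
    reverse ((w ++ a) ++ reverse w)              ≡⟨ reverse-++ (w ++ a) (reverse w) ⟩
    reverse (reverse w) ++ reverse (w ++ a)      ≡⟨ cong₂ _++_ (reverse-involutive w) (reverse-++ w a) ⟩
    w ++ reverse a ++ reverse w                  ≡⟨ cong (λ b → w ++ b ++ reverse w) a-pal ⟩
    w ++ a ++ reverse w                          ≡⟨ ++-assoc w a (reverse w) ⟨
    (w ++ a) ++ reverse w                        ∎

  palindrome-ends-with : ∀ {p s : List A} → IsPalindrome p → IsPalindrome (p ++ s) →
                         length s ≤ length p → ∃[ p′ ] (p′ ++ s ≡ p × IsPalindrome p′)
  palindrome-ends-with {p} {s} p-pal ps-pal s≤p
    with prefix-of-left-factor (reverse s) p (p , s̃p≡ps)
           (subst (_≤ length p) (sym (length-reverse s)) s≤p)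
    where
    s̃p≡ps : reverse s ++ p ≡ p ++ s
    s̃p≡ps = trans (cong (reverse s ++_) (sym p-pal)) (trans (sym (reverse-++ p s)) ps-pal)
  ... | p′ , s̃p′≡p = p′ , p′s≡p , p′-pal
    where
    p′s≡p : p′ ++ s ≡ p
    p′s≡p = ++-cancelˡ (reverse s) _ _ (begin
      reverse s ++ p′ ++ s      ≡⟨ ++-assoc (reverse s) p′ s ⟨
      (reverse s ++ p′) ++ s    ≡⟨ cong (_++ s) s̃p′≡p ⟩
      p ++ s                    ≡⟨ ps-pal ⟨
      reverse (p ++ s)          ≡⟨ reverse-++ p s ⟩
      reverse s ++ reverse p    ≡⟨ cong (reverse s ++_) p-pal ⟩
      reverse s ++ p            ∎)
    p′-pal : IsPalindrome p′
    p′-pal = ++-cancelˡ (reverse s) _ _ (begin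
      reverse s ++ reverse p′   ≡⟨ reverse-++ p′ s ⟨
      reverse (p′ ++ s)         ≡⟨ cong reverse p′s≡p ⟩
      reverse p                 ≡⟨ p-pal ⟩
      p                         ≡⟨ s̃p′≡p ⟨
      reverse s ++ p′           ∎)

  shorten-palindromic-prefix : ∀ n {s : List A} → 0 < length s → length s ≤ n →
    ∀ p → IsPalindrome p → IsPalindrome (p ++ s) → n < length p + length s →
    ∃[ q ] (IsPrefix q p × IsPalindrome q × length q ≤ n × n < length q + length s)
  shorten-palindromic-prefix n {s} s>0 s≤n p p-pal ps-pal n<ps =
    go p p-pal ps-pal n<ps (<-wellFounded (length p))
    where
    go : ∀ p → IsPalindrome p → IsPalindrome (p ++ s) → n < length p + length s →
         Acc _<_ (length p) →
         ∃[ q ] (IsPrefix q p × IsPalindrome q × length q ≤ n × n < length q + length s)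
    go p p-pal ps-pal n<ps (acc shorter) with length p ≤? n
    ... | yes p≤n = p , ([] , ++-identityʳ p) , p-pal , p≤n , n<ps
    ... | no p≰n with palindrome-ends-with p-pal ps-pal (≤-trans s≤n (<⇒≤ (≰⇒> p≰n)))
    ...   | p′ , refl , p′-pal with go p′ p′-pal p-pal (subst (n <_) (length-++ p′) (≰⇒> p≰n))
                                      (shorter (subst (length p′ <_) (sym (length-++ p′)) (m<m+n _ s>0)))
    ...     | q , q⊑p′ , rest = q , prefix-trans q⊑p′ (s , refl) , rest

  proper-palindromic-prefix-++ : ∀ {u} (v : List A) → 0 < length v →
    HasNontrivPalPrefix u → HasNontrivProperPalPrefix (u ++ v)
  proper-palindromic-prefix-++ {u} v v>0 (p , p⊑u , nontrivial) =
    p , prefix-trans p⊑u (v , refl) , p<uv , nontrivial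
    where
    p<uv : length p < length (u ++ v)
    p<uv = subst (length p <_) (sym (length-++ u))
             (≤-<-trans (length-prefix p⊑u) (m<m+n (length u) v>0))

  nonempty-before-short : ∀ (u : List A) {a} → length a ≤ 1 → HasNontrivPalPrefix (u ++ a) →
                          0 < length u
  nonempty-before-short [] a≤1 (p , p⊑a , _ , 2≤p)
    with ≤-trans 2≤p (≤-trans (length-prefix p⊑a) a≤1)
  ... | s≤s ()
  nonempty-before-short (_ ∷ _) _ _ = s≤s z≤n

  palindromic-prefix-of-longer-part : ∀ u (v : List A) → IsPalindrome (u ++ v) →
    length v ≤ length u → HasNontrivProperPalPrefix (u ++ v) → HasNontrivPalPrefix u
  palindromic-prefix-of-longer-part u v uv-pal v≤u (p , p⊑uv@(s , ps≡uv) , p<uv , p-pal , 2≤p)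
    with length p ≤? length u
  ... | yes p≤u = p , prefix-of-left-factor p u p⊑uv p≤u , p-pal , 2≤p
  ... | no p≰u =
    let q , q⊑p , q-pal , q≤u , u<qs =
          shorten-palindromic-prefix (length u) s>0 (≤-trans (<⇒≤ s<v) v≤u) p p-pal
            (subst IsPalindrome (sym ps≡uv) uv-pal) (≤-trans u<p (m≤m+n _ _))
    in q , prefix-of-left-factor q u (prefix-trans q⊑p p⊑uv) q≤u , q-pal ,
       window-lower-bound u<qs s<v v≤u
    where
    u<p : length u < length p
    u<p = ≰⇒> p≰u
    |ps|≡|uv| : length p + length s ≡ length (u ++ v)
    |ps|≡|uv| = trans (sym (length-++ p)) (cong length ps≡uv)
    s>0 : 0 < length s
    s>0 = +-cancelˡ-< (length p) 0 (length s)
            (subst₂ _<_ (sym (+-identityʳ (length p))) (sym |ps|≡|uv|) p<uv)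
    s<v : length s < length v
    s<v = +-cancelˡ-< (length u) (length s) (length v)
            (subst (length u + length s <_) (trans |ps|≡|uv| (length-++ u))
              (+-monoˡ-< (length s) u<p))

lemma13 : ∀ {ℓ} {A : Set ℓ} (w a : List A) → length a ≤ 1 →
    HasNontrivPalPrefix (w ++ a) ⇔ HasNontrivProperPalPrefix (w ++ a ++ reverse w)
lemma13 w a a≤1 = mk⇔ to from
  where
  reassociate : (w ++ a) ++ reverse w ≡ w ++ a ++ reverse w
  reassociate = ++-assoc w a (reverse w)

  to : HasNontrivPalPrefix (w ++ a) → HasNontrivProperPalPrefix (w ++ a ++ reverse w)
  to h = subst HasNontrivProperPalPrefix reassociate
    (proper-palindromic-prefix-++ (reverse w)
      (subst (0 <_) (sym (length-reverse w)) (nonempty-before-short w a≤1 h)) h)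

  from : HasNontrivProperPalPrefix (w ++ a ++ reverse w) → HasNontrivPalPrefix (w ++ a)
  from h = palindromic-prefix-of-longer-part (w ++ a) (reverse w)
    (palindrome-++-reverse w (palindrome-of-length≤1 a a≤1))
    (subst (_≤ length (w ++ a)) (sym (length-reverse w)) (length-++-≤ˡ w))
    (subst HasNontrivProperPalPrefix (sym reassociate) h)
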